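{- Preference-sight consistency does not follow from $\mathbf{BI}=\mathbf{SCBI}$: there exists a preference-sight tree $(T,s)$ with $\mathbf{BI}=\mathbf{SCBI}$ that is not preference-sight consistent.
   Context: A preference tree is $T=(H,\succeq)$ with $H$ a nonempty prefix-closed set of finite action sequences (histories) containing the empty sequence, and $\succeq$ a total (complete, transitive) preference relation on $H$. $h\lhd h'$: $h$ is a prefix of $h'$; $(ha)$: $h$ extended by action $a$; $Z$: terminal histories; $H|_h$: histories extending $h$ (including $h$). A sight function assigns to each $h$ a nonempty finite $s(h)\subseteq H|_h$ with (DC) $h\lhd h'\lhd h''$, $h''\in s(h)\Rightarrow h'\in s(h)$ and (NF) $h\lhd h'\lhd h''$, $h''\in s(h)\Rightarrow h''\in s(h')$; $(T,s)$ is a preference-sight tree. Visible tree at $h$: $H_h=s(h)$, $Z_h$ = elements of $H_h$ with no proper extension in $H_h$. Subjective preference $\succeq_h$ on $H_h$: $h_1\succeq_h h_2$ iff $m_h(h_1)\succeq m_h(h_2)$, where $m_h(g)$ is a $\succeq$-maximal element of $\{z\in Z_h: g\lhd z\}$. $(T,s)$ is preference-sight consistent if for every $h\in H$ and all $h_1,h_2\in H_h$: $h_1\succeq h_2$ iff $h_1\succeq_h h_2$. $\max_{\succeq}\Gamma=\{g\in\Gamma:g\succeq g'\ \forall g'\in\Gamma\}$; $\mathbf{BI}=\max_{\succeq}Z$; $\mathbf{SCBI}$ is the set of $h^*\in Z$ such that for every proper prefix $h$ of $h^*$, with $a$ the action such that $(ha)\lhd h^*$, some $z\in\max_{\succeq}Z_h$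 satisfies $(ha)\lhd z$. -}

module Defs where

open import Level using (Level; suc; _⊔_) renaming (zero to lzero)
open import Data.List using (List; []; _∷_; _++_; _∷ʳ_)
open import Data.List.Membership.Propositional using (_∈_)
open import Data.Product using (Σ; ∃; ∃-syntax; _×_; _,_)
open import Data.Sum using (_⊎_)
open import Relation.Binary.PropositionalEquality using (_≡_)
open import Relation.Nullary using (¬_)

_◁_ : {A : Set} → List A → List A → Set
h ◁ h' = ∃[ t ] (h ++ t ≡ h')

_◁⁺_ : {A : Set} → List A → List A → Set
h ◁⁺ h' = h ◁ h' × ¬ (h ≡ h')

-- A preference-sight tree (T , s) with T = (H , ≿).
-- H is a predicate on finite action sequences; s h is a finite list
-- (a finite subset of H|_h).  Requirements on s are imposed for h ∈ H.
record PSTree (A : Set) : Set₁ where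
  field
    H        : List A → Set
    H-[]     : H []
    H-prefix : ∀ h h' → h ◁ h' → H h' → H h
    _≿_      : List A → List A → Set
    ≿-total  : ∀ h h' → H h → H h' → (h ≿ h') ⊎ (h' ≿ h)
    ≿-trans  : ∀ h₁ h₂ h₃ → H h₁ → H h₂ → H h₃ → h₁ ≿ h₂ → h₂ ≿ h₃ → h₁ ≿ h₃
    s        : List A → List (List A)
    s-nonempty : ∀ h → H h → ∃[ g ] (g ∈ s h)
    s-sub    : ∀ h → H h → ∀ g → g ∈ s h → H g × (h ◁ g)
    s-DC     : ∀ h h' h'' → H h → h ◁ h' → h' ◁ h'' → h'' ∈ s h → h' ∈ s h
    s-NF     : ∀ h h' h'' → H h → h ◁ h' → h' ◁ h'' → h'' ∈ s h → h'' ∈ s h'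

module _ {A : Set} (T : PSTree A) where
  open PSTree T

  Z : List A → Set
  Z z = H z × (∀ a → ¬ H (z ∷ʳ a))

  -- Z_h : elements of H_h = s h with no proper extension in H_h
  Zₕ : List A → List A → Set
  Zₕ h g = g ∈ s h × ¬ (∃[ g' ] (g' ∈ s h × g ◁⁺ g'))

  -- z is a ≿-maximal element of { z ∈ Z_h : g ◁ z }  (a candidate for m_h(g))
  IsMₕ : List A → List A → List A → Set
  IsMₕ h g z = Zₕ h z × g ◁ z × (∀ z' → Zₕ h z' → g ◁ z' → z ≿ z')

  SubjPref : List A → List A → List A → Set
  SubjPref h h₁ h₂ = ∃[ z₁ ] ∃[ z₂ ] (IsMₕ h h₁ z₁ × IsMₕ h h₂ z₂ × z₁ ≿ z₂)

  PSConsistent : Set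
  PSConsistent = ∀ h → H h → ∀ h₁ h₂ → h₁ ∈ s h → h₂ ∈ s h →
                 (h₁ ≿ h₂ → SubjPref h h₁ h₂) × (SubjPref h h₁ h₂ → h₁ ≿ h₂)

  BI : List A → Set
  BI z = Z z × (∀ z' → Z z' → z ≿ z')

  MaxZₕ : List A → List A → Set
  MaxZₕ h z = Zₕ h z × (∀ z' → Zₕ h z' → z ≿ z')

  SCBI : List A → Set
  SCBI z = Z z × (∀ h a → (h ∷ʳ a) ◁ z →
                   ∃[ z' ] (MaxZₕ h z' × (h ∷ʳ a) ◁ z'))

  BI≡SCBI : Set
  BI≡SCBI = ∀ z → (BI z → SCBI z) × (SCBI z → BI z)

{-# OPTIONS --safe #-}
module Submission where

-- The counterexample has one action: histories [] and its only extension ⟨tt⟩,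
-- full sight s(h) = H|_h, and the root strictly preferred to ⟨tt⟩.  With a single
-- terminal history, BI = SCBI = {⟨tt⟩}.  At the root both [] and ⟨tt⟩ have
-- m = ⟨tt⟩, so the subjective preference ranks them equally while the objective
-- one does not: consistency also constrains the preference on non-terminal
-- histories, which BI and SCBI never look at.

open import Defs
open import Data.Empty using (⊥; ⊥-elim)
open import Data.List using (List; []; _∷_; _++_; _∷ʳ_; [_]; length)
open import Data.List.Properties using (++-assoc; ++-identityʳ; ++-identityʳ-unique)
open import Data.List.Membership.Propositional using (_∈_)
open import Data.List.Relation.Unary.Any using (here; there)
open import Data.Nat using (_≤_)
open import Data.Nat.Properties using (≤-refl; ≤-total; ≤-trans)
open import Data.Product using (Σ; ∃-syntax; _×_; _,_; proj₁; proj₂)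
open import Data.Sum using (reduce)
open import Data.Unit using (⊤; tt)
open import Relation.Binary.PropositionalEquality using (_≡_; refl; sym; trans; subst)
open import Relation.Nullary using (¬_)

private variable
  A : Set
  g h h' h'' h₁ h₂ z : List A

◁-refl : (h : List A) → h ◁ h
◁-refl h = [] , ++-identityʳ h

[]◁ : (h : List A) → [] ◁ h
[]◁ h = h , refl

◁-trans : h ◁ h' → h' ◁ h'' → h ◁ h''
◁-trans {h = h} (t , refl) (u , refl) = t ++ u , sym (++-assoc h t u)

◁⁺-∷ʳ : (h : List A) (a : A) → h ◁⁺ (h ∷ʳ a)
◁⁺-∷ʳ h a = ([ a ] , refl) , λ eq → [a]≢[] (++-identityʳ-unique h eq)
  where
  [a]≢[] : ¬ [ a ] ≡ []
  [a]≢[] ()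

◁⁺⇒∷ʳ◁ : h ◁⁺ g → ∃[ a ] (h ∷ʳ a) ◁ g
◁⁺⇒∷ʳ◁ {h = h} (([] , eq) , h≢g) = ⊥-elim (h≢g (trans (sym (++-identityʳ h)) eq))
◁⁺⇒∷ʳ◁ {h = h} ((a ∷ t , refl) , _) = a , t , ++-assoc h [ a ] t

module FullSight {A : Set}
  (H : List A → Set) (H-prefix : ∀ h h' → h ◁ h' → H h' → H h)
  (s : List A → List (List A))
  (s-sub : ∀ h → H h → ∀ g → g ∈ s h → H g × (h ◁ g))
  (s-complete : ∀ h g → H g → h ◁ g → g ∈ s h)
  where

  s-nonempty : ∀ h → H h → ∃[ g ] (g ∈ s h)
  s-nonempty h Hh = h , s-complete h h Hh (◁-refl h)

  s-DC : ∀ h h' h'' → H h → h ◁ h' → h' ◁ h'' → h'' ∈ s h → h' ∈ s h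
  s-DC h h' h'' Hh h◁h' h'◁h'' h''∈ =
    s-complete h h' (H-prefix h' h'' h'◁h'' (proj₁ (s-sub h Hh h'' h''∈))) h◁h'

  s-NF : ∀ h h' h'' → H h → h ◁ h' → h' ◁ h'' → h'' ∈ s h → h'' ∈ s h'
  s-NF h h' h'' Hh _ h'◁h'' h''∈ = s-complete h' h'' (proj₁ (s-sub h Hh h'' h''∈)) h'◁h''

module _ {A : Set} (T : PSTree A) where
  open PSTree T

  ≿-refl : H h → h ≿ h
  ≿-refl {h = h} Hh = reduce (≿-total h h Hh Hh)

  BI≡SCBI-of-unique-terminal : (z₀ : List A) → (∀ z → Z T z → z ≡ z₀) → SCBI T z₀ → BI≡SCBI T
  BI≡SCBI-of-unique-terminal z₀ unique SCBI-z₀ z = BI⇒SCBI , SCBI⇒BI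
    where
    BI⇒SCBI : BI T z → SCBI T z
    BI⇒SCBI (Zz , _) rewrite unique z Zz = SCBI-z₀

    SCBI⇒BI : SCBI T z → BI T z
    SCBI⇒BI (Zz , _) = Zz , λ z' Zz' →
      subst (z ≿_) (trans (unique z Zz) (sym (unique z' Zz'))) (≿-refl (proj₁ Zz))

  common-mₕ⇒¬PSConsistent : ∀ h → H h → h₁ ∈ s h → h₂ ∈ s h →
                             IsMₕ T h h₁ z → IsMₕ T h h₂ z → ¬ h₂ ≿ h₁ → ¬ PSConsistent T
  common-mₕ⇒¬PSConsistent {h₁} {h₂} {z} h Hh h₁∈ h₂∈ m₁ m₂ h₂⋡h₁ consistent =
    h₂⋡h₁ (proj₂ (consistent h Hh h₂ h₁ h₂∈ h₁∈) (z , z , m₂ , m₁ , ≿-refl Hz))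
    where
    Hz : H z
    Hz = proj₁ (s-sub h Hh z (proj₁ (proj₁ m₁)))

  module _ (s-complete : ∀ h g → H g → h ◁ g → g ∈ s h) where

    Zₕ⇒Z : ∀ h → H h → Zₕ T h z → Z T z
    Zₕ⇒Z {z} h Hh (z∈ , maximal) = Hz , λ a Hza →
      maximal (z ∷ʳ a , s-complete h (z ∷ʳ a) Hza (◁-trans h◁z (proj₁ (◁⁺-∷ʳ z a))) , ◁⁺-∷ʳ z a)
      where
      Hz : H z
      Hz = proj₁ (s-sub h Hh z z∈)
      h◁z : h ◁ z
      h◁z = proj₂ (s-sub h Hh z z∈)

    Z⇒Zₕ : ∀ h → H h → h ◁ z → Z T z → Zₕ T h z
    Z⇒Zₕ {z} h Hh h◁z (Hz , terminal) = s-complete h z Hz h◁z , no-extension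
      where
      no-extension : ¬ (∃[ g ] (g ∈ s h × z ◁⁺ g))
      no-extension (g , g∈ , z◁⁺g) with a , za◁g ← ◁⁺⇒∷ʳ◁ z◁⁺g =
        terminal a (H-prefix (z ∷ʳ a) g za◁g (proj₁ (s-sub h Hh g g∈)))

one : List ⊤
one = [ tt ]

Stick : List ⊤ → Set
Stick []          = ⊤
Stick (_ ∷ [])    = ⊤
Stick (_ ∷ _ ∷ _) = ⊥

Stick-prefix : ∀ h h' → h ◁ h' → Stick h' → Stick h
Stick-prefix []          _ _          _ = tt
Stick-prefix (_ ∷ [])    _ _          _ = tt
Stick-prefix (_ ∷ _ ∷ _) _ (_ , refl) ()

sight : List ⊤ → List (List ⊤)
sight []       = [] ∷ one ∷ []
sight (x ∷ xs) = (x ∷ xs) ∷ []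

sight-sub : ∀ h → Stick h → ∀ g → g ∈ sight h → Stick g × (h ◁ g)
sight-sub []       _  _ (here refl)         = tt , []◁ []
sight-sub []       _  _ (there (here refl)) = tt , []◁ one
sight-sub (x ∷ xs) Sh _ (here refl)         = Sh , ◁-refl (x ∷ xs)

sight-complete : ∀ h g → Stick g → h ◁ g → g ∈ sight h
sight-complete []          []          _ _            = here refl
sight-complete []          (_ ∷ [])    _ _            = there (here refl)
sight-complete (_ ∷ _)     []          _ (_ , ())
sight-complete (_ ∷ [])    (_ ∷ [])    _ ([] , refl)  = here refl
sight-complete (_ ∷ [])    (_ ∷ [])    _ (_ ∷ _ , ())
sight-complete (_ ∷ _ ∷ _) (_ ∷ [])    _ (_ , ())
sight-complete _           (_ ∷ _ ∷ _) () _

stick : PSTree ⊤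
stick = record
  { H          = Stick
  ; H-[]       = tt
  ; H-prefix   = Stick-prefix
  ; _≿_        = λ h h' → length h ≤ length h'
  ; ≿-total    = λ h h' _ _ → ≤-total (length h) (length h')
  ; ≿-trans    = λ _ _ _ _ _ _ → ≤-trans
  ; s          = sight
  ; s-nonempty = s-nonempty
  ; s-sub      = sight-sub
  ; s-DC       = s-DC
  ; s-NF       = s-NF
  }
  where open FullSight Stick Stick-prefix sight sight-sub sight-complete

Z-one : Z stick one
Z-one = tt , λ _ ()

Z⇒≡one : ∀ z → Z stick z → z ≡ one
Z⇒≡one []          (_ , terminal) = ⊥-elim (terminal tt tt)
Z⇒≡one (_ ∷ [])    _              = refl
Z⇒≡one (_ ∷ _ ∷ _) (() , _)

Zₕ-root-one : Zₕ stick [] one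
Zₕ-root-one = Z⇒Zₕ stick sight-complete [] tt ([]◁ one) Z-one

one-≿-Zₕ-root : Zₕ stick [] z → PSTree._≿_ stick one z
one-≿-Zₕ-root {z = z} Zz rewrite Z⇒≡one z (Zₕ⇒Z stick sight-complete [] tt Zz) = ≤-refl

one-isMₕ-root : g ◁ one → IsMₕ stick [] g one
one-isMₕ-root g◁one = Zₕ-root-one , g◁one , λ _ Zz _ → one-≿-Zₕ-root Zz

SCBI-one : SCBI stick one
SCBI-one = Z-one , one-optimal-at
  where
  one-optimal-at : ∀ h a → (h ∷ʳ a) ◁ one → ∃[ z ] (MaxZₕ stick h z × (h ∷ʳ a) ◁ z)
  one-optimal-at []          _ a◁one = one , (Zₕ-root-one , λ _ → one-≿-Zₕ-root) , a◁one
  one-optimal-at (_ ∷ [])    _ (_ , ())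
  one-optimal-at (_ ∷ _ ∷ _) _ (_ , ())

mainTheorem4 : Σ Set (λ A → Σ (PSTree A) (λ T → BI≡SCBI T × ¬ PSConsistent T))
mainTheorem4 =
  ⊤ , stick ,
  BI≡SCBI-of-unique-terminal stick one Z⇒≡one SCBI-one ,
  common-mₕ⇒¬PSConsistent stick [] tt (here refl) (there (here refl))
    (one-isMₕ-root ([]◁ one)) (one-isMₕ-root (◁-refl one)) λ ()
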